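{- Let $d\in\mathbb N\cup\{\infty\}$ and let $w=(w_{i,j})\in\mathbb Z^{V_d}$ be an outcome with $\#\mathrm{supp}^-(w)=1$. Write $c_0=\min\{i\mid (i,j)\in V_d,\ w_{i,j}\neq0\}$, $r_0=\min\{j\mid (i,j)\in V_d,\ w_{i,j}\neq0\}$ and $d'=d-c_0-r_0$. Then $(w_{c_0+i,r_0+j})_{(i,j)\in V_{d'}}\in\mathbb Z^{V_{d'}}$ is a valid outcome. In particular, if $c_0=r_0=0$ then $w$ is a valid outcome.
   Context: $V_d=\{(i,j)\in\mathbb Z_{\geq0}^2\mid i+j\leq d\}$. A chip configuration is a finitely supported $w\in\mathbb Z^{V_d}$. A splitting move at $p\in V_{d-1}$ decreases $w_p$ by $1$ and increases $w_{p+(1,0)}$, $w_{p+(0,1)}$ by $1$; an unsplitting move is its inverse; an outcome is a configuration reachable from the zero configuration by finitely many moves. $\mathrm{supp}^-(w)=\{(i,j)\mid w_{i,j}<0\}$; $w$ is valid if $\mathrm{supp}^-(w)\subseteq\{(0,0)\}$. -}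

module Defs where

open import Data.Nat as ℕ using (ℕ; zero; suc; _≡ᵇ_; _∸_)
open import Data.Integer as ℤ using (ℤ; 0ℤ; 1ℤ; -1ℤ)
open import Data.Bool using (Bool; true; false; if_then_else_; _∧_)
open import Data.List using (List; foldr)
open import Data.List.Relation.Unary.All using (All)
open import Data.Product using (Σ; ∃; _×_; _,_)
open import Data.Unit using (⊤)
open import Relation.Nullary using (¬_)
open import Relation.Binary.PropositionalEquality using (_≡_)

data ℕ∞ : Set where
  fin : ℕ → ℕ∞
  ∞   : ℕ∞

InV : ℕ∞ → ℕ → ℕ → Set
InV (fin d) i j = i ℕ.+ j ℕ.≤ d
InV ∞       i j = ⊤

InV-1 : ℕ∞ → ℕ → ℕ → Set
InV-1 (fin d) i j = suc (i ℕ.+ j) ℕ.≤ d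
InV-1 ∞       i j = ⊤

-- d - c - r  (truncated subtraction on finite d, ∞ - c - r = ∞)
_∸∞_ : ℕ∞ → ℕ → ℕ∞
fin d ∸∞ n = fin (d ∸ n)
∞     ∸∞ n = ∞

-- configurations: values on V_d (values off V_d are ignored everywhere)
Config : Set
Config = ℕ → ℕ → ℤ

zeroConfig : Config
zeroConfig _ _ = 0ℤ

data Kind : Set where
  split unsplit : Kind

record Move : Set where
  constructor move
  field
    kind : Kind
    pi   : ℕ
    pj   : ℕ
open Move public

sgn : Kind → ℤ
sgn split   = 1ℤ
sgn unsplit = -1ℤ

δ : ℕ → ℕ → ℕ → ℕ → ℤ
δ a b i j = if (a ≡ᵇ i) ∧ (b ≡ᵇ j) then 1ℤ else 0ℤ

-- splitting at p = (a,b): w_p -= 1, w_{p+(1,0)} += 1, w_{p+(0,1)} += 1;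
-- unsplitting is the inverse.
applyMove : Move → Config → Config
applyMove (move k a b) w i j =
  w i j ℤ.+ sgn k ℤ.* ((δ (suc a) b i j ℤ.+ δ a (suc b) i j) ℤ.- δ a b i j)

applyMoves : List Move → Config → Config
applyMoves ms w = foldr applyMove w ms

LegalMove : ℕ∞ → Move → Set
LegalMove d m = InV-1 d (pi m) (pj m)

Outcome : ℕ∞ → Config → Set
Outcome d w = Σ (List Move) λ ms →
  All (LegalMove d) ms ×
  (∀ i j → InV d i j → applyMoves ms zeroConfig i j ≡ w i j)

Valid : ℕ∞ → Config → Set
Valid d w = ∀ i j → InV d i j → w i j ℤ.< 0ℤ → (i ≡ 0) × (j ≡ 0)

NegSuppSingleton : ℕ∞ → Config → Set
NegSuppSingleton d w = Σ ℕ λ a → Σ ℕ λ b →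
  InV d a b × (w a b ℤ.< 0ℤ) ×
  (∀ i j → InV d i j → w i j ℤ.< 0ℤ → (i ≡ a) × (j ≡ b))

IsMinCol : ℕ∞ → Config → ℕ → Set
IsMinCol d w c = (Σ ℕ λ j → InV d c j × ¬ (w c j ≡ 0ℤ)) ×
  (∀ i j → InV d i j → ¬ (w i j ≡ 0ℤ) → c ℕ.≤ i)

IsMinRow : ℕ∞ → Config → ℕ → Set
IsMinRow d w r = (Σ ℕ λ i → InV d i r × ¬ (w i r ≡ 0ℤ)) ×
  (∀ i j → InV d i j → ¬ (w i j ≡ 0ℤ) → r ℕ.≤ j)

shift : Config → ℕ → ℕ → Config
shift w c r i j = w (c ℕ.+ i) (r ℕ.+ j)

-- A list of moves has a net split count N : V_{d-1} → ℤ, and its outcome is w = ∂N with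
-- ∂N(i,j) = N(i-1,j) + N(i,j-1) - N(i,j).  Left of the first nonzero column c₀ of w this
-- recurrence forces N = 0, so on column c₀ it reads N(c₀,j) = N(c₀,j-1) - w(c₀,j): going
-- up the column, -N accumulates the entries of w.  N vanishes at the top of the column (on
-- the boundary of V_d, or beyond its finite support when d = ∞), so the column cannot be
-- nonnegative with a nonzero entry; hence the unique negative entry lies in column c₀ and,
-- by transposition, in row r₀.  Since N vanishes below row r₀ and left of column c₀, the
-- moves at points ≥ (c₀,r₀), translated to the origin, produce the translated
-- configuration, whose only negative entry is at (0,0).
module Submission where

open import Defs
open import Data.Nat using (ℕ; _+_)
open import Data.Product using (_×_)
open import Relation.Binary.PropositionalEquality using (_≡_)

open import Data.Bool using (true; false; T)
open import Data.Empty using (⊥-elim)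
import Data.Integer as ℤ
open ℤ using (ℤ; 0ℤ)
import Data.Integer.Properties as ℤₚ
open import Data.Integer.Tactic.RingSolver using (solve-∀)
open import Data.List using (List; []; _∷_)
open import Data.List.Relation.Unary.All as All using (All; []; _∷_)
open import Data.Nat as ℕ using (zero; suc; _≤_; _<_; ≤′-refl; ≤′-step; _∸_)
import Data.Nat.Properties as ℕₚ
open import Algebra.Properties.CommutativeSemigroup ℕₚ.+-commutativeSemigroup using (interchange)
open import Data.Product using (Σ; _,_; proj₁; proj₂)
import Data.Product as Product
open import Data.Unit using (tt)
open import Function using (flip)
open import Relation.Nullary using (¬_; Dec; yes; no)
open import Relation.Nullary.Decidable using (_×-dec_; decidable-stable)
open import Relation.Binary.PropositionalEquality
  using (refl; sym; trans; cong; cong₂; subst; subst₂; module ≡-Reasoning)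

pred-col : Config → Config
pred-col F zero    j = 0ℤ
pred-col F (suc i) j = F i j

pred-row : Config → Config
pred-row F i zero    = 0ℤ
pred-row F i (suc j) = F i j

∂ : Config → Config
∂ F i j = (pred-col F i j ℤ.+ pred-row F i j) ℤ.- F i j

splitCount : List Move → Config
splitCount []       i j = 0ℤ
splitCount (m ∷ ms) i j = splitCount ms i j ℤ.+ sgn (kind m) ℤ.* δ (pi m) (pj m) i j

private
  0+s*0≡0 : ∀ s → 0ℤ ℤ.+ s ℤ.* 0ℤ ≡ 0ℤ
  0+s*0≡0 s = trans (ℤₚ.+-identityˡ _) (ℤₚ.*-zeroʳ s)

δ-off : ∀ {a b i j} → ¬ (a ≡ i × b ≡ j) → δ a b i j ≡ 0ℤ
δ-off {a} {b} {i} {j} ¬ab≡ij with a ℕ.≡ᵇ i in a≡ᵇi | b ℕ.≡ᵇ j in b≡ᵇj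
... | true  | true  = ⊥-elim (¬ab≡ij (ℕₚ.≡ᵇ⇒≡ a i (subst T (sym a≡ᵇi) tt) ,
                                     ℕₚ.≡ᵇ⇒≡ b j (subst T (sym b≡ᵇj) tt)))
... | true  | false = refl
... | false | _     = refl

δ-translate : ∀ c r a b i j → δ (c + a) (r + b) (c + i) (r + j) ≡ δ a b i j
δ-translate zero    zero    a b i j = refl
δ-translate zero    (suc r) a b i j = δ-translate zero r a b i j
δ-translate (suc c) r       a b i j = δ-translate c r a b i j

δ-suc-col : ∀ a b i j → δ (suc a) b i j ≡ pred-col (δ a b) i j
δ-suc-col a b zero    j = refl
δ-suc-col a b (suc i) j = refl

δ-suc-row : ∀ a b i j → δ a (suc b) i j ≡ pred-row (δ a b) i j
δ-suc-row a b i zero with a ℕ.≡ᵇ i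
... | true  = refl
... | false = refl
δ-suc-row a b i (suc j) = refl

-- Outcomes as ∂ of the split count

∂-cong : ∀ {F G} → (∀ i j → F i j ≡ G i j) → ∀ i j → ∂ F i j ≡ ∂ G i j
∂-cong {F} {G} F≗G i j = cong₂ ℤ._-_ (cong₂ ℤ._+_ (col i) (row j)) (F≗G i j)
  where
  col : ∀ i → pred-col F i j ≡ pred-col G i j
  col zero    = refl
  col (suc i) = F≗G i j
  row : ∀ j → pred-row F i j ≡ pred-row G i j
  row zero    = refl
  row (suc j) = F≗G i j

∂-add-move : ∀ F s a b i j →
  ∂ (λ x y → F x y ℤ.+ s ℤ.* δ a b x y) i j ≡
  ∂ F i j ℤ.+ s ℤ.* ((δ (suc a) b i j ℤ.+ δ a (suc b) i j) ℤ.- δ a b i j)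
∂-add-move F s a b i j = begin
  (pred-col F′ i j ℤ.+ pred-row F′ i j) ℤ.- F′ i j
    ≡⟨ cong₂ (λ x y → (x ℤ.+ y) ℤ.- F′ i j) (col i) (row j) ⟩
  ((pred-col F i j ℤ.+ s ℤ.* pred-col (δ a b) i j) ℤ.+ (pred-row F i j ℤ.+ s ℤ.* pred-row (δ a b) i j))
    ℤ.- F′ i j
    ≡⟨ regroup (pred-col F i j) (pred-row F i j) (F i j) s _ _ (δ a b i j) ⟩
  ∂ F i j ℤ.+ s ℤ.* ((pred-col (δ a b) i j ℤ.+ pred-row (δ a b) i j) ℤ.- δ a b i j)
    ≡⟨ cong₂ (λ x y → ∂ F i j ℤ.+ s ℤ.* ((x ℤ.+ y) ℤ.- δ a b i j))
         (sym (δ-suc-col a b i j)) (sym (δ-suc-row a b i j)) ⟩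
  ∂ F i j ℤ.+ s ℤ.* ((δ (suc a) b i j ℤ.+ δ a (suc b) i j) ℤ.- δ a b i j) ∎
  where
  open ≡-Reasoning
  F′ : Config
  F′ x y = F x y ℤ.+ s ℤ.* δ a b x y
  col : ∀ i → pred-col F′ i j ≡ pred-col F i j ℤ.+ s ℤ.* pred-col (δ a b) i j
  col zero    = sym (0+s*0≡0 s)
  col (suc i) = refl
  row : ∀ j → pred-row F′ i j ≡ pred-row F i j ℤ.+ s ℤ.* pred-row (δ a b) i j
  row zero    = sym (0+s*0≡0 s)
  row (suc j) = refl
  regroup : ∀ l d n s x y z →
    ((l ℤ.+ s ℤ.* x) ℤ.+ (d ℤ.+ s ℤ.* y)) ℤ.- (n ℤ.+ s ℤ.* z) ≡
    ((l ℤ.+ d) ℤ.- n) ℤ.+ s ℤ.* ((x ℤ.+ y) ℤ.- z)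
  regroup = solve-∀

applyMoves-splitCount : ∀ ms i j → applyMoves ms zeroConfig i j ≡ ∂ (splitCount ms) i j
applyMoves-splitCount []               zero    zero    = refl
applyMoves-splitCount []               zero    (suc j) = refl
applyMoves-splitCount []               (suc i) zero    = refl
applyMoves-splitCount []               (suc i) (suc j) = refl
applyMoves-splitCount (move k a b ∷ ms) i j =
  trans (cong (ℤ._+ _) (applyMoves-splitCount ms i j))
        (sym (∂-add-move (splitCount ms) (sgn k) a b i j))

splitCount-outside : (P : ℕ → ℕ → Set) → ∀ {ms} → All (λ m → P (pi m) (pj m)) ms →
                     ∀ {a b} → ¬ P a b → splitCount ms a b ≡ 0ℤ
splitCount-outside P []                         ¬Pab = refl
splitCount-outside P {move k x y ∷ ms} (Pxy ∷ Pms) {a} {b} ¬Pab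
  rewrite splitCount-outside P Pms ¬Pab
        | δ-off {x} {y} {a} {b} (λ { (refl , refl) → ¬Pab Pxy })
        = 0+s*0≡0 (sgn k)

moves-bounded : ∀ ms → Σ ℕ λ n → All (LegalMove (fin n)) ms
moves-bounded []                = 0 , []
moves-bounded (move k a b ∷ ms) with moves-bounded ms
... | n , legal = suc (a + b) + n , ℕₚ.m≤m+n (suc (a + b)) n
                ∷ All.map (λ p → ℕₚ.≤-trans p (ℕₚ.m≤n+m n (suc (a + b)))) legal

InV-1⇒InV : ∀ d {i j} → InV-1 d i j → InV d i j
InV-1⇒InV (fin n) = ℕₚ.<⇒≤
InV-1⇒InV ∞       = λ _ → tt

InV-1? : ∀ d i j → Dec (InV-1 d i j)
InV-1? (fin n) i j = suc (i + j) ℕ.≤? n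
InV-1? ∞       i j = yes tt

InV-flip : ∀ d i j → InV d i j → InV d j i
InV-flip (fin n) i j = subst (_≤ n) (ℕₚ.+-comm i j)
InV-flip ∞       i j = λ _ → tt

InV-1-flip : ∀ d i j → InV-1 d i j → InV-1 d j i
InV-1-flip (fin n) i j = subst (λ k → suc k ≤ n) (ℕₚ.+-comm i j)
InV-1-flip ∞       i j = λ _ → tt

InV-down : ∀ d {i j J} → j ≤ J → InV d i J → InV d i j
InV-down (fin n) {i} j≤J iJ∈V = ℕₚ.≤-trans (ℕₚ.+-monoʳ-≤ i j≤J) iJ∈V
InV-down ∞       _   _      = tt

translate-sum : ∀ c r i j → (c + i) + (r + j) ≡ (i + j) + (c + r)
translate-sum c r i j = trans (interchange c i r j) (ℕₚ.+-comm (c + r) (i + j))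

InV-translate : ∀ d {c r i j} → InV d c r → InV (d ∸∞ (c + r)) i j → InV d (c + i) (r + j)
InV-translate (fin n) {c} {r} {i} {j} cr∈V ij∈V′ =
  subst (_≤ n) (sym (translate-sum c r i j)) (ℕₚ.m≤o∸n⇒m+n≤o (i + j) cr∈V ij∈V′)
InV-translate ∞ _ _ = tt

InV-1-translate : ∀ d {c r a b} → InV-1 d (c + a) (r + b) → InV-1 (d ∸∞ (c + r)) a b
InV-1-translate (fin n) {c} {r} {a} {b} ab∈V =
  ℕₚ.m+n≤o⇒m≤o∸n (suc (a + b)) (subst (λ k → suc k ≤ n) (translate-sum c r a b) ab∈V)
InV-1-translate ∞ _ = tt

-- Split counts and the first nonzero column

record IsSplitCount (d : ℕ∞) (w F : Config) : Set where
  field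
    ∂-agrees      : ∀ i j → InV d i j → w i j ≡ ∂ F i j
    outside-V-1   : ∀ i j → ¬ InV-1 d i j → F i j ≡ 0ℤ
    bound         : ℕ   -- finite support; only needed when d = ∞
    outside-bound : ∀ i j → ¬ InV-1 (fin bound) i j → F i j ≡ 0ℤ
open IsSplitCount

outcome⇒isSplitCount : ∀ {d w} (o : Outcome d w) → IsSplitCount d w (splitCount (proj₁ o))
outcome⇒isSplitCount {d} (ms , legal , agrees) = record
  { ∂-agrees      = λ i j ij∈V → trans (sym (agrees i j ij∈V)) (applyMoves-splitCount ms i j)
  ; outside-V-1   = λ i j → splitCount-outside (InV-1 d) legal
  ; bound         = proj₁ (moves-bounded ms)
  ; outside-bound = λ i j → splitCount-outside (InV-1 (fin _)) (proj₂ (moves-bounded ms))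
  }

∂-flip : ∀ F i j → ∂ (flip F) i j ≡ ∂ F j i
∂-flip F i j = cong (ℤ._- F j i)
  (trans (cong₂ ℤ._+_ (col i) (row j)) (ℤₚ.+-comm (pred-row F j i) (pred-col F j i)))
  where
  col : ∀ i → pred-col (flip F) i j ≡ pred-row F j i
  col zero    = refl
  col (suc i) = refl
  row : ∀ j → pred-row (flip F) i j ≡ pred-col F j i
  row zero    = refl
  row (suc j) = refl

isSplitCount-flip : ∀ {d w F} → IsSplitCount d w F → IsSplitCount d (flip w) (flip F)
isSplitCount-flip {d} {w} {F} S = record
  { ∂-agrees      = λ i j ij∈V → trans (∂-agrees S j i (InV-flip d i j ij∈V)) (sym (∂-flip F i j))
  ; outside-V-1   = λ i j ij∉V → outside-V-1 S j i (λ ji∈V → ij∉V (InV-1-flip d j i ji∈V))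
  ; bound         = bound S
  ; outside-bound = λ i j ij∉V →
      outside-bound S j i (λ ji∈V → ij∉V (InV-1-flip (fin (bound S)) j i ji∈V))
  }

split-count-recurrence : ∀ {d w F} → IsSplitCount d w F → ∀ {i j} → InV d i j →
                         F i j ≡ (pred-col F i j ℤ.+ pred-row F i j) ℤ.- w i j
split-count-recurrence {F = F} S {i} {j} ij∈V =
  trans (solve-for-F inflow (F i j)) (cong (ℤ._-_ inflow) (sym (∂-agrees S i j ij∈V)))
  where
  inflow : ℤ
  inflow = pred-col F i j ℤ.+ pred-row F i j
  solve-for-F : ∀ x f → f ≡ x ℤ.- (x ℤ.- f)
  solve-for-F = solve-∀

pred-col-vanishes : ∀ {F c} → (∀ i → i < c → ∀ j → F i j ≡ 0ℤ) → ∀ j → pred-col F c j ≡ 0ℤ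
pred-col-vanishes {c = zero}  cols j = refl
pred-col-vanishes {c = suc c} cols j = cols c ℕₚ.≤-refl j

pred-row-vanishes : ∀ {F r} → (∀ j → j < r → ∀ i → F i j ≡ 0ℤ) → ∀ i → pred-row F i r ≡ 0ℤ
pred-row-vanishes {r = zero}  rows i = refl
pred-row-vanishes {r = suc r} rows i = rows r ℕₚ.≤-refl i

SupportFromColumn : ℕ∞ → Config → ℕ → Set
SupportFromColumn d w c = ∀ i j → InV d i j → ¬ (w i j ≡ 0ℤ) → c ≤ i

columns-left-vanish : ∀ {d w F c} → IsSplitCount d w F → SupportFromColumn d w c →
                      ∀ i → i < c → ∀ j → F i j ≡ 0ℤ
columns-left-vanish {d} {w} {F} {c} S support = go
  where
  open ≡-Reasoning
  at : ∀ {i j} → i < c → pred-col F i j ≡ 0ℤ → pred-row F i j ≡ 0ℤ → F i j ≡ 0ℤ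
  at {i} {j} i<c col≡0 row≡0 with InV-1? d i j
  ... | no  ij∉V = outside-V-1 S i j ij∉V
  ... | yes ij∈V = begin
    F i j                                          ≡⟨ split-count-recurrence S ij∈V′ ⟩
    (pred-col F i j ℤ.+ pred-row F i j) ℤ.- w i j  ≡⟨ cong₂ ℤ._-_ (cong₂ ℤ._+_ col≡0 row≡0) w≡0 ⟩
    0ℤ                                             ∎
    where
    ij∈V′ = InV-1⇒InV d ij∈V
    w≡0 : w i j ≡ 0ℤ
    w≡0 = decidable-stable (w i j ℤₚ.≟ 0ℤ) (λ w≢0 → ℕₚ.<⇒≱ i<c (support i j ij∈V′ w≢0))
  go : ∀ i → i < c → ∀ j → F i j ≡ 0ℤ
  go zero    i<c zero    = at i<c refl refl
  go zero    i<c (suc j) = at i<c refl (go zero i<c j)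
  go (suc i) i<c zero    = at i<c (go i (ℕₚ.<⇒≤ i<c) 0) refl
  go (suc i) i<c (suc j) = at i<c (go i (ℕₚ.<⇒≤ i<c) (suc j)) (go (suc i) i<c j)

neg-count-step : ∀ {d w F c} → IsSplitCount d w F → (∀ j → pred-col F c j ≡ 0ℤ) →
                 ∀ {j} → InV d c j → ℤ.- F c j ≡ ℤ.- pred-row F c j ℤ.+ w c j
neg-count-step {w = w} {F} {c} S col≡0 {j} cj∈V = begin
  ℤ.- F c j
    ≡⟨ cong ℤ.-_ (split-count-recurrence S cj∈V) ⟩
  ℤ.- ((pred-col F c j ℤ.+ pred-row F c j) ℤ.- w c j)
    ≡⟨ cong (λ x → ℤ.- ((x ℤ.+ pred-row F c j) ℤ.- w c j)) (col≡0 j) ⟩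
  ℤ.- ((0ℤ ℤ.+ pred-row F c j) ℤ.- w c j)
    ≡⟨ negate (pred-row F c j) (w c j) ⟩
  ℤ.- pred-row F c j ℤ.+ w c j ∎
  where
  open ≡-Reasoning
  negate : ∀ p x → ℤ.- ((0ℤ ℤ.+ p) ℤ.- x) ≡ ℤ.- p ℤ.+ x
  negate = solve-∀

column-entry≤neg-count : ∀ {d w F c} → IsSplitCount d w F → (∀ j → pred-col F c j ≡ 0ℤ) →
                         ∀ {J} → InV d c J → (∀ j → j ≤ J → 0ℤ ℤ.≤ w c j) →
                         ∀ j → j ≤ J → w c j ℤ.≤ ℤ.- F c J
column-entry≤neg-count {d} {w} {F} {c} S col≡0 = go
  where
  go : ∀ {J} → InV d c J → (∀ j → j ≤ J → 0ℤ ℤ.≤ w c j) → ∀ j → j ≤ J → w c j ℤ.≤ ℤ.- F c J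
  go {zero} cJ∈V nonneg zero ℕ.z≤n =
    ℤₚ.≤-reflexive (sym (trans (neg-count-step S col≡0 cJ∈V) (ℤₚ.+-identityˡ (w c 0))))
  go {suc J} cJ∈V nonneg j j≤1+J =
    subst (w c j ℤ.≤_) (sym (neg-count-step S col≡0 cJ∈V)) (step (ℕₚ.≤⇒≤′ j≤1+J))
    where
    ih : ∀ j → j ≤ J → w c j ℤ.≤ ℤ.- F c J
    ih = go (InV-down d (ℕₚ.n≤1+n J) cJ∈V) (λ j j≤J → nonneg j (ℕₚ.m≤n⇒m≤1+n j≤J))
    step : ∀ {j} → j ℕ.≤′ suc J → w c j ℤ.≤ ℤ.- F c J ℤ.+ w c (suc J)
    step ≤′-refl = ℤₚ.i≤j+i _ _ {{ℤ.nonNegative (ℤₚ.≤-trans (nonneg J (ℕₚ.n≤1+n J)) (ih J ℕₚ.≤-refl))}}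
    step (≤′-step j≤′J) =
      ℤₚ.≤-trans (ih _ (ℕₚ.≤′⇒≤ j≤′J)) (ℤₚ.i≤i+j _ _ {{ℤ.nonNegative (nonneg (suc J) ℕₚ.≤-refl)}})

count-vanishes-above : ∀ {d w F} → IsSplitCount d w F → ∀ {c j₁} → InV d c j₁ →
                       Σ ℕ λ J → j₁ ≤ J × InV d c J × F c J ≡ 0ℤ
count-vanishes-above {fin n} S {c} {j₁} cj₁∈V =
  n ∸ c , j₁≤n∸c , ℕₚ.≤-reflexive top , outside-V-1 S c (n ∸ c) (λ lt → ℕₚ.n≮n n (subst (_< n) top lt))
  where
  top : c + (n ∸ c) ≡ n
  top = ℕₚ.m+[n∸m]≡n (ℕₚ.m+n≤o⇒m≤o c cj₁∈V)
  j₁≤n∸c : j₁ ≤ n ∸ c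
  j₁≤n∸c = ℕₚ.m+n≤o⇒m≤o∸n j₁ (subst (_≤ n) (ℕₚ.+-comm c j₁) cj₁∈V)
count-vanishes-above {∞} S {c} {j₁} _ =
  j₁ + bound S , ℕₚ.m≤m+n j₁ (bound S) , tt ,
  outside-bound S c (j₁ + bound S)
    (λ lt → ℕₚ.<⇒≱ lt (ℕₚ.≤-trans (ℕₚ.m≤n+m (bound S) j₁) (ℕₚ.m≤n+m (j₁ + bound S) c)))

min-column-not-nonnegative : ∀ {d w F c} → IsSplitCount d w F → IsMinCol d w c →
                             ¬ (∀ j → InV d c j → 0ℤ ℤ.≤ w c j)
min-column-not-nonnegative {d} {w} {F} {c} S ((j₁ , cj₁∈V , w≢0) , support) nonneg
  with count-vanishes-above S cj₁∈V
... | J , j₁≤J , cJ∈V , F≡0 = w≢0 (ℤₚ.≤-antisym w≤0 (nonneg j₁ cj₁∈V))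
  where
  w≤-F : w c j₁ ℤ.≤ ℤ.- F c J
  w≤-F = column-entry≤neg-count S (pred-col-vanishes (columns-left-vanish S support)) cJ∈V
           (λ j j≤J → nonneg j (InV-down d j≤J cJ∈V)) j₁ j₁≤J
  w≤0 : w c j₁ ℤ.≤ 0ℤ
  w≤0 = subst (λ x → w c j₁ ℤ.≤ ℤ.- x) F≡0 w≤-F

negatives-in-min-column : ∀ {d w F c a} → IsSplitCount d w F →
                          (∀ i j → InV d i j → w i j ℤ.< 0ℤ → i ≡ a) → IsMinCol d w c → c ≡ a
negatives-in-min-column {c = c} {a} S neg⇒a min-col = decidable-stable (c ℕ.≟ a) λ c≢a →
  min-column-not-nonnegative S min-col (λ j cj∈V → ℤₚ.≮⇒≥ (λ w<0 → c≢a (neg⇒a c j cj∈V w<0)))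

isMinRow⇒isMinCol-flip : ∀ {d w r} → IsMinRow d w r → IsMinCol d (flip w) r
isMinRow⇒isMinCol-flip {d} {r = r} ((i , ir∈V , w≢0) , support) =
  (i , InV-flip d i r ir∈V , w≢0) , λ i j ij∈V w≢0 → support j i (InV-flip d i j ij∈V) w≢0

negatives-at-min-corner : ∀ {d w F a b c r} → IsSplitCount d w F →
                          (∀ i j → InV d i j → w i j ℤ.< 0ℤ → (i ≡ a) × (j ≡ b)) →
                          IsMinCol d w c → IsMinRow d w r → (c ≡ a) × (r ≡ b)
negatives-at-min-corner {d} S neg⇒ab min-col min-row =
  negatives-in-min-column S (λ i j ij∈V w<0 → proj₁ (neg⇒ab i j ij∈V w<0)) min-col ,
  negatives-in-min-column (isSplitCount-flip S)
    (λ i j ij∈V w<0 → proj₂ (neg⇒ab j i (InV-flip d i j ij∈V) w<0)) (isMinRow⇒isMinCol-flip min-row)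

-- Translating to the corner (c , r)

shiftMoves : ℕ → ℕ → List Move → List Move
shiftMoves c r []                = []
shiftMoves c r (move k a b ∷ ms) with c ℕ.≤? a ×-dec r ℕ.≤? b
... | yes _ = move k (a ∸ c) (b ∸ r) ∷ shiftMoves c r ms
... | no  _ = shiftMoves c r ms

splitCount-shiftMoves : ∀ c r ms i j → splitCount (shiftMoves c r ms) i j ≡ shift (splitCount ms) c r i j
splitCount-shiftMoves c r []                i j = refl
splitCount-shiftMoves c r (move k a b ∷ ms) i j with c ℕ.≤? a ×-dec r ℕ.≤? b
... | yes (c≤a , r≤b) =
  cong₂ (λ x y → x ℤ.+ sgn k ℤ.* y) (splitCount-shiftMoves c r ms i j) (sym δ-shift)
  where
  δ-shift : δ a b (c + i) (r + j) ≡ δ (a ∸ c) (b ∸ r) i j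
  δ-shift = subst₂ (λ x y → δ x y (c + i) (r + j) ≡ δ (a ∸ c) (b ∸ r) i j)
              (ℕₚ.m+[n∸m]≡n c≤a) (ℕₚ.m+[n∸m]≡n r≤b) (δ-translate c r (a ∸ c) (b ∸ r) i j)
... | no ¬c≤a×r≤b
  rewrite δ-off {a} {b} {c + i} {r + j}
            (λ { (refl , refl) → ¬c≤a×r≤b (ℕₚ.m≤m+n c i , ℕₚ.m≤m+n r j) })
        | ℤₚ.*-zeroʳ (sgn k)
        | ℤₚ.+-identityʳ (splitCount ms (c + i) (r + j))
        = splitCount-shiftMoves c r ms i j

shiftMoves-legal : ∀ d c r {ms} → All (LegalMove d) ms → All (LegalMove (d ∸∞ (c + r))) (shiftMoves c r ms)
shiftMoves-legal d c r []                                = []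
shiftMoves-legal d c r {move k a b ∷ ms} (ab∈V ∷ legal) with c ℕ.≤? a ×-dec r ℕ.≤? b
... | yes (c≤a , r≤b) =
  InV-1-translate d (subst₂ (InV-1 d) (sym (ℕₚ.m+[n∸m]≡n c≤a)) (sym (ℕₚ.m+[n∸m]≡n r≤b)) ab∈V)
  ∷ shiftMoves-legal d c r legal
... | no _ = shiftMoves-legal d c r legal

∂-shift : ∀ {F c r} → (∀ i → i < c → ∀ j → F i j ≡ 0ℤ) → (∀ j → j < r → ∀ i → F i j ≡ 0ℤ) →
          ∀ i j → ∂ (shift F c r) i j ≡ ∂ F (c + i) (r + j)
∂-shift {F} {c} {r} cols rows i j = cong (ℤ._- F (c + i) (r + j)) (cong₂ ℤ._+_ (col i) (row j))
  where
  col : ∀ i → pred-col (shift F c r) i j ≡ pred-col F (c + i) (r + j)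
  col zero    rewrite ℕₚ.+-identityʳ c = sym (pred-col-vanishes cols (r + j))
  col (suc i) rewrite ℕₚ.+-suc c i     = refl
  row : ∀ j → pred-row (shift F c r) i j ≡ pred-row F (c + i) (r + j)
  row zero    rewrite ℕₚ.+-identityʳ r = sym (pred-row-vanishes rows (c + i))
  row (suc j) rewrite ℕₚ.+-suc r j     = refl

shift-outcome : ∀ {d w c r} (o : Outcome d w) → InV d c r →
                (∀ i → i < c → ∀ j → splitCount (proj₁ o) i j ≡ 0ℤ) →
                (∀ j → j < r → ∀ i → splitCount (proj₁ o) i j ≡ 0ℤ) →
                Outcome (d ∸∞ (c + r)) (shift w c r)
shift-outcome {d} {w} {c} {r} (ms , legal , agrees) cr∈V cols rows =
  shiftMoves c r ms , shiftMoves-legal d c r legal , λ i j ij∈V′ → begin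
    applyMoves (shiftMoves c r ms) zeroConfig i j  ≡⟨ applyMoves-splitCount (shiftMoves c r ms) i j ⟩
    ∂ (splitCount (shiftMoves c r ms)) i j         ≡⟨ ∂-cong (splitCount-shiftMoves c r ms) i j ⟩
    ∂ (shift (splitCount ms) c r) i j              ≡⟨ ∂-shift cols rows i j ⟩
    ∂ (splitCount ms) (c + i) (r + j)              ≡⟨ applyMoves-splitCount ms (c + i) (r + j) ⟨
    applyMoves ms zeroConfig (c + i) (r + j)       ≡⟨ agrees (c + i) (r + j) (InV-translate d cr∈V ij∈V′) ⟩
    w (c + i) (r + j)                              ∎
  where open ≡-Reasoning

shift-valid : ∀ {d w c r} → InV d c r → (∀ i j → InV d i j → w i j ℤ.< 0ℤ → (i ≡ c) × (j ≡ r)) →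
              Valid (d ∸∞ (c + r)) (shift w c r)
shift-valid {d} {c = c} {r} cr∈V neg⇒cr i j ij∈V′ w<0 =
  Product.map (cancel c i) (cancel r j) (neg⇒cr (c + i) (r + j) (InV-translate d cr∈V ij∈V′) w<0)
  where
  cancel : ∀ m n → m + n ≡ m → n ≡ 0
  cancel m n m+n≡m = ℕₚ.+-cancelˡ-≡ m n 0 (trans m+n≡m (sym (ℕₚ.+-identityʳ m)))

proposition3p22 : (d : ℕ∞) (w : Config) → Outcome d w → NegSuppSingleton d w →
    (c₀ r₀ : ℕ) → IsMinCol d w c₀ → IsMinRow d w r₀ →
    (Valid (d ∸∞ (c₀ + r₀)) (shift w c₀ r₀) × Outcome (d ∸∞ (c₀ + r₀)) (shift w c₀ r₀))
    × (c₀ ≡ 0 → r₀ ≡ 0 → Valid d w × Outcome d w)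
proposition3p22 d w o (a , b , ab∈V , _ , neg⇒ab) c₀ r₀ min-col min-row
  with negatives-at-min-corner (outcome⇒isSplitCount o) neg⇒ab min-col min-row
... | refl , refl =
  (shift-valid ab∈V neg⇒ab , shift-outcome o ab∈V cols rows) , λ { refl refl → neg⇒ab , o }
  where
  S : IsSplitCount d w (splitCount (proj₁ o))
  S = outcome⇒isSplitCount o
  cols : ∀ i → i < c₀ → ∀ j → splitCount (proj₁ o) i j ≡ 0ℤ
  cols = columns-left-vanish S (proj₂ min-col)
  rows : ∀ j → j < r₀ → ∀ i → splitCount (proj₁ o) i j ≡ 0ℤ
  rows = columns-left-vanish (isSplitCount-flip S) (proj₂ (isMinRow⇒isMinCol-flip min-row))
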